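{- Fix $n\ge 2$. Then $\max_{v\in V(\times_m P_n)}|l(v)|\to 0$ as $m\to\infty$; that is, the leverage centralities of all vertices of $\times_m P_n$ converge to $0$ as $m\to\infty$.
   Context: $\times_m P_n$ is the Cartesian product of $m$ copies of the path $P_n$: its vertices are the $m$-tuples $(v_1,\dots,v_m)\in\{1,\dots,n\}^m$, and two vertices are adjacent iff they differ in exactly one coordinate, and there by exactly $1$. For a vertex $v$ of positive degree, with neighborhood $N_v$, the leverage centrality is $l(v)=\frac{1}{\deg(v)}\sum_{w\in N_v}\frac{\deg(v)-\deg(w)}{\deg(v)+\deg(w)}$. -}

module Defs where

open import Data.Nat as ℕ using (ℕ; zero; suc; ∣_-_∣; _≡ᵇ_)
open import Data.Bool using (Bool; true; false; _∧_; _∨_)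
open import Data.Fin using (Fin; toℕ)
open import Data.Vec using (Vec; []; _∷_)
open import Data.List using (List; []; _∷_; [_]; map; concatMap; allFin; filterᵇ; length)
open import Data.Integer using (ℤ; +_; _-_)
open import Data.Rational using (ℚ; 0ℚ; _/_; _*_; _+_)

-- Vertices of ×_m P_n : m-tuples with coordinates in {1..n}, encoded as Fin n
-- (coordinate value i ∈ Fin n stands for i+1).
Vertex : ℕ → ℕ → Set
Vertex n m = Vec (Fin n) m

eqV : ∀ {n m} → Vertex n m → Vertex n m → Bool
eqV [] [] = true
eqV (a ∷ u) (b ∷ w) = (toℕ a ≡ᵇ toℕ b) ∧ eqV u w

adj : ∀ {n m} → Vertex n m → Vertex n m → Bool
adj [] [] = false
adj (a ∷ u) (b ∷ w) =
  ((∣ toℕ a - toℕ b ∣ ≡ᵇ 1) ∧ eqV u w) ∨ ((toℕ a ≡ᵇ toℕ b) ∧ adj u w)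

allVertices : ∀ n m → List (Vertex n m)
allVertices n zero = [ [] ]
allVertices n (suc m) = concatMap (λ a → map (a ∷_) (allVertices n m)) (allFin n)

nbhd : ∀ {n m} → Vertex n m → List (Vertex n m)
nbhd {n} {m} v = filterᵇ (adj v) (allVertices n m)

deg : ∀ {n m} → Vertex n m → ℕ
deg v = length (nbhd v)

-- a / d as a rational, with the (never used below) convention a / 0 = 0
divℚ : ℤ → ℕ → ℚ
divℚ a zero = 0ℚ
divℚ a (suc d) = a / suc d

sumℚ : List ℚ → ℚ
sumℚ [] = 0ℚ
sumℚ (x ∷ xs) = x + sumℚ xs

-- leverage centrality l(v) = (1/deg v) Σ_{w ∈ N_v} (deg v - deg w)/(deg v + deg w)
-- (for deg v = 0 this evaluates to 0; such vertices only occur for m = 0 when n ≥ 2)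
leverage : ∀ {n m} → Vertex n m → ℚ
leverage v =
  divℚ (+ 1) (deg v) *
  sumℚ (map (λ w → divℚ (+ deg v - + deg w) (deg v ℕ.+ deg w)) (nbhd v))

-- In ×_m P_n the degree of a vertex is the sum over its coordinates of their degrees in
-- P_n, each of which is 1 or 2 once n ≥ 2.  So every vertex has degree at least m, and
-- adjacent vertices, which differ in a single coordinate, have degrees differing by at
-- most 1.  Each term (d_v − d_w)/(d_v + d_w) of the leverage is then at most 1/m in
-- absolute value, hence so is their mean l(v).

module Submission where

open import Algebra.Bundles using (CommutativeRing)
open import Data.Bool using (Bool; true; false; T; T?; _∧_; _∨_; if_then_else_)
open import Data.Bool.Properties using (T-∧; T-∨; ∨-identityʳ; ∧-zeroʳ)
open import Data.Fin using (Fin; toℕ) renaming (zero to fzero; suc to fsuc)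
open import Data.Fin.Properties using (toℕ<n; toℕ-injective)
open import Data.Integer as ℤ using (ℤ; +_; +≤+; +<+; -[1+_])
import Data.Integer.Properties as ℤ
open import Data.Integer.Tactic.RingSolver using (solve-∀)
open import Data.List using (List; []; _∷_; [_]; _++_; map; concatMap; filterᵇ; length; allFin; tabulate)
open import Data.List.Properties using (map-tabulate; map-cong)
open import Data.List.Relation.Unary.All as All using (All; []; _∷_)
open import Data.List.Relation.Unary.All.Properties using (all-filter)
open import Data.Nat as ℕ hiding (_/_)
open import Data.Nat.ListAction using (sum)
open import Data.Nat.Properties
open import Data.Product using (_×_; _,_; ∃-syntax)
open import Data.Rational as ℚ using (ℚ; mkℚ; 0ℚ; 1ℚ; _/_; *<*; toℚᵘ)
import Data.Rational.Properties as ℚ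
open import Data.Rational.Unnormalised as ℚᵘ using (mkℚᵘ)
import Data.Rational.Unnormalised.Properties as ℚᵘ
open import Data.Sum using (_⊎_; inj₁; inj₂)
open import Data.Vec using ([]; _∷_)
open import Function using (_∘_; id; Equivalence)
open import Level using (Level)
open import Relation.Binary.PropositionalEquality
  using (_≡_; refl; sym; trans; cong; cong₂; subst₂; module ≡-Reasoning)

open import Algebra.Properties.CommutativeSemigroup +-commutativeSemigroup using (interchange)
open import Algebra.Properties.Semiring.Mult (CommutativeRing.semiring ℚ.+-*-commutativeRing)
  using (×-assoc-*) renaming (_×_ to _×ℚ_)
open import Defs

private
  variable
    a b : Level
    A : Set a
    B : Set b

countᵇ : (A → Bool) → List A → ℕ
countᵇ p []       = 0
countᵇ p (x ∷ xs) = if p x then suc (countᵇ p xs) else countᵇ p xs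

length-filterᵇ : ∀ (p : A → Bool) xs → length (filterᵇ p xs) ≡ countᵇ p xs
length-filterᵇ p []       = refl
length-filterᵇ p (x ∷ xs) with p x
... | true  = cong suc (length-filterᵇ p xs)
... | false = length-filterᵇ p xs

countᵇ-cong : ∀ {p q : A → Bool} → (∀ x → p x ≡ q x) → ∀ xs → countᵇ p xs ≡ countᵇ q xs
countᵇ-cong p≗q []       = refl
countᵇ-cong {q = q} p≗q (x ∷ xs) rewrite p≗q x with q x
... | true  = cong suc (countᵇ-cong p≗q xs)
... | false = countᵇ-cong p≗q xs

countᵇ-false : ∀ (xs : List A) → countᵇ (λ _ → false) xs ≡ 0
countᵇ-false []       = refl
countᵇ-false (x ∷ xs) = countᵇ-false xs

countᵇ-++ : ∀ (p : A → Bool) xs ys → countᵇ p (xs ++ ys) ≡ countᵇ p xs + countᵇ p ys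
countᵇ-++ p []       ys = refl
countᵇ-++ p (x ∷ xs) ys with p x
... | true  = cong suc (countᵇ-++ p xs ys)
... | false = countᵇ-++ p xs ys

countᵇ-map : ∀ (p : B → Bool) (f : A → B) xs → countᵇ p (map f xs) ≡ countᵇ (p ∘ f) xs
countᵇ-map p f []       = refl
countᵇ-map p f (x ∷ xs) with p (f x)
... | true  = cong suc (countᵇ-map p f xs)
... | false = countᵇ-map p f xs

countᵇ-concatMap : ∀ (p : B → Bool) (f : A → List B) xs →
                  countᵇ p (concatMap f xs) ≡ sum (map (countᵇ p ∘ f) xs)
countᵇ-concatMap p f []       = refl
countᵇ-concatMap p f (x ∷ xs) = begin
  countᵇ p (f x ++ concatMap f xs)             ≡⟨ countᵇ-++ p (f x) (concatMap f xs) ⟩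
  countᵇ p (f x) + countᵇ p (concatMap f xs)   ≡⟨ cong (countᵇ p (f x) ℕ.+_) (countᵇ-concatMap p f xs) ⟩
  countᵇ p (f x) + sum (map (countᵇ p ∘ f) xs) ∎
  where open ≡-Reasoning

countᵇ-∧ˡ : ∀ x (p : A → Bool) ys → countᵇ (λ y → x ∧ p y) ys ≡ (if x then countᵇ p ys else 0)
countᵇ-∧ˡ true  p ys = refl
countᵇ-∧ˡ false p ys = countᵇ-false ys

countᵇ-∨-disjoint : ∀ x y (p q : A → Bool) ys → x ∧ y ≡ false →
  countᵇ (λ z → (x ∧ p z) ∨ (y ∧ q z)) ys ≡ (if x then countᵇ p ys else 0) + (if y then countᵇ q ys else 0)
countᵇ-∨-disjoint true  true  p q ys ()
countᵇ-∨-disjoint true  false p q ys _ = trans (countᵇ-cong (∨-identityʳ ∘ p) ys) (sym (+-identityʳ _))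
countᵇ-∨-disjoint false y     p q ys _ = countᵇ-∧ˡ y q ys

countᵇ-allFin-suc : ∀ n (p : Fin (suc n) → Bool) →
  countᵇ p (allFin (suc n)) ≡ countᵇ p [ fzero ] + countᵇ (p ∘ fsuc) (allFin n)
countᵇ-allFin-suc n p = begin
  countᵇ p ([ fzero ] ++ tabulate fsuc)
    ≡⟨ countᵇ-++ p [ fzero ] (tabulate fsuc) ⟩
  countᵇ p [ fzero ] + countᵇ p (tabulate fsuc)
    ≡⟨ cong (λ xs → countᵇ p [ fzero ] + countᵇ p xs) (map-tabulate id fsuc) ⟨
  countᵇ p [ fzero ] + countᵇ p (map fsuc (allFin n))
    ≡⟨ cong (countᵇ p [ fzero ] ℕ.+_) (countᵇ-map p fsuc (allFin n)) ⟩
  countᵇ p [ fzero ] + countᵇ (p ∘ fsuc) (allFin n) ∎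
  where open ≡-Reasoning

sum-map-+ : ∀ (f g : A → ℕ) xs → sum (map (λ x → f x + g x) xs) ≡ sum (map f xs) + sum (map g xs)
sum-map-+ f g []       = refl
sum-map-+ f g (x ∷ xs) rewrite sum-map-+ f g xs = interchange (f x) (g x) _ _

sum-map-if : ∀ (p : A → Bool) k xs → sum (map (λ x → if p x then k else 0) xs) ≡ countᵇ p xs * k
sum-map-if p k []       = refl
sum-map-if p k (x ∷ xs) with p x
... | true  = cong (k ℕ.+_) (sum-map-if p k xs)
... | false = sum-map-if p k xs

countᵇ-≡ᵇ-allFin : ∀ {n} (i : Fin n) → countᵇ (λ j → toℕ i ≡ᵇ toℕ j) (allFin n) ≡ 1
countᵇ-≡ᵇ-allFin {suc n} fzero    = trans (countᵇ-allFin-suc n (λ j → 0 ≡ᵇ toℕ j)) (cong suc (countᵇ-false (allFin n)))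
countᵇ-≡ᵇ-allFin {suc n} (fsuc i) = trans (countᵇ-allFin-suc n (λ j → toℕ (fsuc i) ≡ᵇ toℕ j)) (countᵇ-≡ᵇ-allFin i)

pathNeighbours : ℕ → ℕ → ℕ
pathNeighbours k n = countᵇ (λ j → ∣ k - toℕ j ∣ ≡ᵇ 1) (allFin n)

pathNeighbours-zero : ∀ n → pathNeighbours 0 (suc (suc n)) ≡ 1
pathNeighbours-zero n = begin
  pathNeighbours 0 (suc (suc n))               ≡⟨ countᵇ-allFin-suc (suc n) (λ j → ∣ 0 - toℕ j ∣ ≡ᵇ 1) ⟩
  countᵇ (λ j → toℕ j ≡ᵇ 0) (allFin (suc n))   ≡⟨ countᵇ-allFin-suc n (λ j → toℕ j ≡ᵇ 0) ⟩
  suc (countᵇ (λ _ → false) (allFin n))        ≡⟨ cong suc (countᵇ-false (allFin n)) ⟩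
  1                                            ∎
  where open ≡-Reasoning

pathNeighbours-suc : ∀ k n →
  pathNeighbours (suc k) (suc n) ≡ (if k ≡ᵇ 0 then 1 else 0) + pathNeighbours k n
pathNeighbours-suc k n = countᵇ-allFin-suc n (λ j → ∣ suc k - toℕ j ∣ ≡ᵇ 1)

pathNeighbours-zero≤1 : ∀ n → pathNeighbours 0 n ≤ 1
pathNeighbours-zero≤1 zero          = z≤n
pathNeighbours-zero≤1 (suc zero)    = z≤n
pathNeighbours-zero≤1 (suc (suc n)) = ≤-reflexive (pathNeighbours-zero n)

pathNeighbours≤2 : ∀ k n → pathNeighbours k n ≤ 2
pathNeighbours≤2 zero          n       = m≤n⇒m≤1+n (pathNeighbours-zero≤1 n)
pathNeighbours≤2 (suc k)       zero    = z≤n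
pathNeighbours≤2 (suc zero)    (suc n) rewrite pathNeighbours-suc zero n = s≤s (pathNeighbours-zero≤1 n)
pathNeighbours≤2 (suc (suc k)) (suc n) rewrite pathNeighbours-suc (suc k) n = pathNeighbours≤2 (suc k) n

pathNeighbours≥1 : ∀ {k n} → 2 ≤ n → k < n → 1 ≤ pathNeighbours k n
pathNeighbours≥1 {zero}        {suc zero}    (s≤s ()) _
pathNeighbours≥1 {zero}        {suc (suc n)} _ _ = ≤-reflexive (sym (pathNeighbours-zero n))
pathNeighbours≥1 {suc zero}    {suc n}       _ _ rewrite pathNeighbours-suc zero n = s≤s z≤n
pathNeighbours≥1 {suc (suc k)} {suc n}       _ (s≤s k+1<n) rewrite pathNeighbours-suc (suc k) n =
  pathNeighbours≥1 (≤-trans (s≤s (s≤s z≤n)) k+1<n) k+1<n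

∣m-n∣≡ᵇ1∧m≡ᵇn≡false : ∀ m n → (∣ m - n ∣ ≡ᵇ 1) ∧ (m ≡ᵇ n) ≡ false
∣m-n∣≡ᵇ1∧m≡ᵇn≡false zero    zero    = refl
∣m-n∣≡ᵇ1∧m≡ᵇn≡false zero    (suc n) = ∧-zeroʳ _
∣m-n∣≡ᵇ1∧m≡ᵇn≡false (suc m) zero    = ∧-zeroʳ _
∣m-n∣≡ᵇ1∧m≡ᵇn≡false (suc m) (suc n) = ∣m-n∣≡ᵇ1∧m≡ᵇn≡false m n

countᵇ-allVertices-suc : ∀ n m (p : Vertex n (suc m) → Bool) →
  countᵇ p (allVertices n (suc m)) ≡ sum (map (λ i → countᵇ (p ∘ (i ∷_)) (allVertices n m)) (allFin n))
countᵇ-allVertices-suc n m p = trans (countᵇ-concatMap p _ (allFin n))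
  (cong sum (map-cong (λ i → countᵇ-map p (i ∷_) (allVertices n m)) (allFin n)))

countᵇ-eqV : ∀ n m (u : Vertex n m) → countᵇ (eqV u) (allVertices n m) ≡ 1
countᵇ-eqV n zero    []      = refl
countᵇ-eqV n (suc m) (i ∷ u) = begin
  countᵇ (eqV (i ∷ u)) (allVertices n (suc m))
    ≡⟨ countᵇ-allVertices-suc n m (eqV (i ∷ u)) ⟩
  sum (map (λ j → countᵇ (λ w → same j ∧ eqV u w) V) (allFin n))
    ≡⟨ cong sum (map-cong (λ j → countᵇ-∧ˡ (same j) (eqV u) V) (allFin n)) ⟩
  sum (map (λ j → if same j then countᵇ (eqV u) V else 0) (allFin n))
    ≡⟨ sum-map-if same _ (allFin n) ⟩
  countᵇ same (allFin n) * countᵇ (eqV u) V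
    ≡⟨ cong₂ _*_ (countᵇ-≡ᵇ-allFin i) (countᵇ-eqV n m u) ⟩
  1 ∎
  where
  open ≡-Reasoning
  V : List (Vertex n m)
  V = allVertices n m
  same : Fin n → Bool
  same j = toℕ i ≡ᵇ toℕ j

deg-∷ : ∀ {n m} (i : Fin n) (u : Vertex n m) → deg (i ∷ u) ≡ pathNeighbours (toℕ i) n + deg u
deg-∷ {n} {m} i u = begin
  deg (i ∷ u)
    ≡⟨ length-filterᵇ (adj (i ∷ u)) (allVertices n (suc m)) ⟩
  countᵇ (adj (i ∷ u)) (allVertices n (suc m))
    ≡⟨ countᵇ-allVertices-suc n m (adj (i ∷ u)) ⟩
  sum (map (λ j → countᵇ (λ w → (step j ∧ eqV u w) ∨ (same j ∧ adj u w)) V) (allFin n))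
    ≡⟨ cong sum (map-cong (λ j → countᵇ-∨-disjoint (step j) (same j) (eqV u) (adj u) V
                                   (∣m-n∣≡ᵇ1∧m≡ᵇn≡false (toℕ i) (toℕ j))) (allFin n)) ⟩
  sum (map (λ j → (if step j then countᵇ (eqV u) V else 0) + (if same j then countᵇ (adj u) V else 0)) (allFin n))
    ≡⟨ sum-map-+ _ _ (allFin n) ⟩
  sum (map (λ j → if step j then countᵇ (eqV u) V else 0) (allFin n))
    + sum (map (λ j → if same j then countᵇ (adj u) V else 0) (allFin n))
    ≡⟨ cong₂ _+_ (sum-map-if step _ (allFin n)) (sum-map-if same _ (allFin n)) ⟩
  pathNeighbours (toℕ i) n * countᵇ (eqV u) V + countᵇ same (allFin n) * countᵇ (adj u) V
    ≡⟨ cong₂ (λ x y → pathNeighbours (toℕ i) n * x + y * countᵇ (adj u) V) (countᵇ-eqV n m u) (countᵇ-≡ᵇ-allFin i) ⟩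
  pathNeighbours (toℕ i) n * 1 + 1 * countᵇ (adj u) V
    ≡⟨ cong₂ _+_ (*-identityʳ _) (trans (*-identityˡ _) (sym (length-filterᵇ (adj u) V))) ⟩
  pathNeighbours (toℕ i) n + deg u ∎
  where
  open ≡-Reasoning
  V : List (Vertex n m)
  V = allVertices n m
  step same : Fin n → Bool
  step j = ∣ toℕ i - toℕ j ∣ ≡ᵇ 1
  same j = toℕ i ≡ᵇ toℕ j

m≤deg : ∀ {n m} → 2 ≤ n → (v : Vertex n m) → m ≤ deg v
m≤deg 2≤n []      = z≤n
m≤deg 2≤n (i ∷ u) rewrite deg-∷ i u = +-mono-≤ (pathNeighbours≥1 2≤n (toℕ<n i)) (m≤deg 2≤n u)

eqV⇒≡ : ∀ {n m} (u w : Vertex n m) → T (eqV u w) → u ≡ w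
eqV⇒≡ []      []      _  = refl
eqV⇒≡ (i ∷ u) (j ∷ w) eq with Equivalence.to (T-∧ {toℕ i ≡ᵇ toℕ j}) eq
... | i≡j , u≡w = cong₂ _∷_ (toℕ-injective (≡ᵇ⇒≡ (toℕ i) (toℕ j) i≡j)) (eqV⇒≡ u w u≡w)

∣m-n∣≤1 : ∀ {m n} → 1 ≤ m → m ≤ 2 → 1 ≤ n → n ≤ 2 → ∣ m - n ∣ ≤ 1
∣m-n∣≤1 {suc m} {suc n} _ (s≤s m≤1) _ (s≤s n≤1) = ≤-trans (∣m-n∣≤m⊔n m n) (⊔-lub m≤1 n≤1)

adj-∷ : ∀ {n m} (i j : Fin n) (u w : Vertex n m) → T (adj (i ∷ u) (j ∷ w)) →
        (∣ toℕ i - toℕ j ∣ ≡ 1 × u ≡ w) ⊎ (i ≡ j × T (adj u w))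
adj-∷ i j u w ij with Equivalence.to (T-∨ {(∣ toℕ i - toℕ j ∣ ≡ᵇ 1) ∧ eqV u w}) ij
... | inj₁ step = let |i-j|≡1 , u≡w = Equivalence.to (T-∧ {∣ toℕ i - toℕ j ∣ ≡ᵇ 1}) step in
  inj₁ (≡ᵇ⇒≡ _ 1 |i-j|≡1 , eqV⇒≡ u w u≡w)
... | inj₂ step = let i≡j , uw = Equivalence.to (T-∧ {toℕ i ≡ᵇ toℕ j}) step in
  inj₂ (toℕ-injective (≡ᵇ⇒≡ (toℕ i) (toℕ j) i≡j) , uw)

adj⇒∣deg-deg∣≤1 : ∀ {n m} → 2 ≤ n → (v w : Vertex n m) → T (adj v w) → ∣ deg v - deg w ∣ ≤ 1
adj⇒∣deg-deg∣≤1 2≤n []      []      ()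
adj⇒∣deg-deg∣≤1 {n} 2≤n (i ∷ u) (j ∷ w) vw with adj-∷ i j u w vw
... | inj₁ (_ , refl) = begin
  ∣ deg (i ∷ u) - deg (j ∷ u) ∣    ≡⟨ cong₂ ∣_-_∣ (trans (deg-∷ i u) (+-comm (p i) (deg u)))
                                                  (trans (deg-∷ j u) (+-comm (p j) (deg u))) ⟩
  ∣ deg u + p i - deg u + p j ∣    ≡⟨ ∣m+n-m+o∣≡∣n-o∣ (deg u) (p i) (p j) ⟩
  ∣ p i - p j ∣                    ≤⟨ ∣m-n∣≤1 (p≥1 i) (p≤2 i) (p≥1 j) (p≤2 j) ⟩
  1                                ∎
  where
  open ≤-Reasoning
  p : Fin n → ℕ
  p k = pathNeighbours (toℕ k) n
  p≥1 : ∀ k → 1 ≤ p k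
  p≥1 k = pathNeighbours≥1 2≤n (toℕ<n k)
  p≤2 : ∀ k → p k ≤ 2
  p≤2 k = pathNeighbours≤2 (toℕ k) n
... | inj₂ (refl , uw) = begin
  ∣ deg (i ∷ u) - deg (i ∷ w) ∣    ≡⟨ cong₂ ∣_-_∣ (deg-∷ i u) (deg-∷ i w) ⟩
  ∣ p + deg u - p + deg w ∣        ≡⟨ ∣m+n-m+o∣≡∣n-o∣ p (deg u) (deg w) ⟩
  ∣ deg u - deg w ∣                ≤⟨ adj⇒∣deg-deg∣≤1 2≤n u w uw ⟩
  1                                ∎
  where
  open ≤-Reasoning
  p : ℕ
  p = pathNeighbours (toℕ i) n

∣m⊖n∣≡∣m-n∣ : ∀ m n → ℤ.∣ m ℤ.⊖ n ∣ ≡ ∣ m - n ∣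
∣m⊖n∣≡∣m-n∣ m n with ≤-total m n
... | inj₁ m≤n = trans (ℤ.∣⊖∣-≤ m≤n) (sym (m≤n⇒∣m-n∣≡n∸m m≤n))
... | inj₂ n≤m = trans (ℤ.∣m⊖n∣≡∣n⊖m∣ m n) (trans (ℤ.∣⊖∣-≤ n≤m) (sym (m≤n⇒∣n-m∣≡n∸m n≤m)))

∣[+m]-[+n]∣≡∣m-n∣ : ∀ m n → ℤ.∣ + m ℤ.- + n ∣ ≡ ∣ m - n ∣
∣[+m]-[+n]∣≡∣m-n∣ m n = trans (cong ℤ.∣_∣ (ℤ.[+m]-[+n]≡m⊖n m n)) (∣m⊖n∣≡∣m-n∣ m n)

∣i/[1+k]∣≤1/[1+j] : ∀ (i : ℤ) {j k} → ℤ.∣ i ∣ ≤ 1 → j ≤ k → ℚ.∣ i / suc k ∣ ℚ.≤ + 1 / suc j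
∣i/[1+k]∣≤1/[1+j] i {j} {k} ∣i∣≤1 j≤k = ℚ.toℚᵘ-cancel-≤ (begin
  toℚᵘ ℚ.∣ i / suc k ∣         ≃⟨ ℚ.toℚᵘ-homo-∣-∣ (i / suc k) ⟩
  ℚᵘ.∣ toℚᵘ (i / suc k) ∣     ≃⟨ ℚᵘ.∣-∣-cong (ℚ.toℚᵘ-fromℚᵘ (mkℚᵘ i k)) ⟩
  ℚᵘ.∣ mkℚᵘ i k ∣             ≤⟨ ℚᵘ.*≤* cross ⟩
  mkℚᵘ (+ 1) j                ≃⟨ ℚ.toℚᵘ-fromℚᵘ (mkℚᵘ (+ 1) j) ⟨
  toℚᵘ (+ 1 / suc j)          ∎)
  where
  open ℚᵘ.≤-Reasoning
  cross : + ℤ.∣ i ∣ ℤ.* + suc j ℤ.≤ + 1 ℤ.* + suc k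
  cross = subst₂ ℤ._≤_ (ℤ.pos-* ℤ.∣ i ∣ (suc j)) (ℤ.pos-* 1 (suc k)) (+≤+ (*-mono-≤ ∣i∣≤1 (s≤s j≤k)))

∣[m-n]/[m+n]∣≤1/[1+j] : ∀ {m n j} → ∣ m - n ∣ ≤ 1 → suc j ≤ m →
                        ℚ.∣ divℚ (+ m ℤ.- + n) (m + n) ∣ ℚ.≤ + 1 / suc j
∣[m-n]/[m+n]∣≤1/[1+j] {suc m} {n} ∣m-n∣≤1 (s≤s j≤m) =
  ∣i/[1+k]∣≤1/[1+j] (+ suc m ℤ.- + n)
    (subst₂ _≤_ (sym (∣[+m]-[+n]∣≡∣m-n∣ (suc m) n)) refl ∣m-n∣≤1)
    (m≤n⇒m≤n+o n j≤m)

[1+n]/1≡1+n/1 : ∀ n → + suc n / 1 ≡ 1ℚ ℚ.+ + n / 1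
[1+n]/1≡1+n/1 n = ℚ.toℚᵘ-injective (begin-equality
  toℚᵘ (+ suc n / 1)                      ≃⟨ ℚ.toℚᵘ-fromℚᵘ (mkℚᵘ (+ suc n) 0) ⟩
  mkℚᵘ (+ suc n) 0                        ≃⟨ ℚᵘ.*≡* (cross (+ n)) ⟩
  mkℚᵘ (+ 1) 0 ℚᵘ.+ mkℚᵘ (+ n) 0          ≃⟨ ℚᵘ.+-cong (ℚ.toℚᵘ-fromℚᵘ (mkℚᵘ (+ 1) 0)) (ℚ.toℚᵘ-fromℚᵘ (mkℚᵘ (+ n) 0)) ⟨
  toℚᵘ 1ℚ ℚᵘ.+ toℚᵘ (+ n / 1)             ≃⟨ ℚ.toℚᵘ-homo-+ 1ℚ (+ n / 1) ⟨
  toℚᵘ (1ℚ ℚ.+ + n / 1)                   ∎)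
  where
  open ℚᵘ.≤-Reasoning
  cross : ∀ x → (+ 1 ℤ.+ x) ℤ.* + 1 ≡ (+ 1 ℤ.* + 1 ℤ.+ x ℤ.* + 1) ℤ.* + 1
  cross = solve-∀

n×1≡n/1 : ∀ n → n ×ℚ 1ℚ ≡ + n / 1
n×1≡n/1 zero    = refl
n×1≡n/1 (suc n) = trans (cong (1ℚ ℚ.+_) (n×1≡n/1 n)) (sym ([1+n]/1≡1+n/1 n))

1/[1+n]*[1+n]/1≡1 : ∀ n → (+ 1 / suc n) ℚ.* (+ suc n / 1) ≡ 1ℚ
1/[1+n]*[1+n]/1≡1 n = ℚ.toℚᵘ-injective (begin-equality
  toℚᵘ ((+ 1 / suc n) ℚ.* (+ suc n / 1))         ≃⟨ ℚ.toℚᵘ-homo-* (+ 1 / suc n) (+ suc n / 1) ⟩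
  toℚᵘ (+ 1 / suc n) ℚᵘ.* toℚᵘ (+ suc n / 1)     ≃⟨ ℚᵘ.*-cong (ℚ.toℚᵘ-fromℚᵘ (mkℚᵘ (+ 1) n)) (ℚ.toℚᵘ-fromℚᵘ (mkℚᵘ (+ suc n) 0)) ⟩
  mkℚᵘ (+ 1) n ℚᵘ.* mkℚᵘ (+ suc n) 0             ≃⟨ ℚᵘ.*-inverseˡ (mkℚᵘ (+ suc n) 0) ⟩
  mkℚᵘ (+ 1) 0                                   ≃⟨ ℚ.toℚᵘ-fromℚᵘ (mkℚᵘ (+ 1) 0) ⟨
  toℚᵘ 1ℚ                                        ∎)
  where open ℚᵘ.≤-Reasoning

1/[1+n]*[[1+n]×p]≡p : ∀ n p → (+ 1 / suc n) ℚ.* (suc n ×ℚ p) ≡ p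
1/[1+n]*[[1+n]×p]≡p n p = begin
  (+ 1 / suc n) ℚ.* (suc n ×ℚ p)                     ≡⟨ cong ((+ 1 / suc n) ℚ.*_) n×p≡n/1*p ⟩
  (+ 1 / suc n) ℚ.* ((+ suc n / 1) ℚ.* p)            ≡⟨ ℚ.*-assoc (+ 1 / suc n) (+ suc n / 1) p ⟨
  ((+ 1 / suc n) ℚ.* (+ suc n / 1)) ℚ.* p            ≡⟨ cong (ℚ._* p) (1/[1+n]*[1+n]/1≡1 n) ⟩
  1ℚ ℚ.* p                                           ≡⟨ ℚ.*-identityˡ p ⟩
  p                                                  ∎
  where
  open ≡-Reasoning
  n×p≡n/1*p : suc n ×ℚ p ≡ (+ suc n / 1) ℚ.* p
  n×p≡n/1*p = begin
    suc n ×ℚ p                ≡⟨ cong (suc n ×ℚ_) (ℚ.*-identityˡ p) ⟨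
    suc n ×ℚ (1ℚ ℚ.* p)       ≡⟨ ×-assoc-* (suc n) 1ℚ p ⟨
    (suc n ×ℚ 1ℚ) ℚ.* p       ≡⟨ cong (ℚ._* p) (n×1≡n/1 (suc n)) ⟩
    (+ suc n / 1) ℚ.* p       ∎

∣sumℚ∣≤length× : ∀ (f : A → ℚ) {p} xs → All (λ x → ℚ.∣ f x ∣ ℚ.≤ p) xs →
                 ℚ.∣ sumℚ (map f xs) ∣ ℚ.≤ length xs ×ℚ p
∣sumℚ∣≤length× f []       []             = ℚ.≤-refl
∣sumℚ∣≤length× f (x ∷ xs) (fx≤p ∷ fxs≤p) =
  ℚ.≤-trans (ℚ.∣p+q∣≤∣p∣+∣q∣ (f x) _) (ℚ.+-mono-≤ fx≤p (∣sumℚ∣≤length× f xs fxs≤p))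

∣mean∣≤ : ∀ (f : A → ℚ) {p} xs → 1 ≤ length xs → All (λ x → ℚ.∣ f x ∣ ℚ.≤ p) xs →
          ℚ.∣ divℚ (+ 1) (length xs) ℚ.* sumℚ (map f xs) ∣ ℚ.≤ p
∣mean∣≤ f {p} xs 1≤len bounded with length xs | ∣sumℚ∣≤length× f xs bounded
∣mean∣≤ f xs () bounded | zero  | _
∣mean∣≤ f {p} xs 1≤len bounded | suc n | ∣Σ∣≤ = begin
  ℚ.∣ (+ 1 / suc n) ℚ.* Σ ∣           ≡⟨ ℚ.∣p*q∣≡∣p∣*∣q∣ (+ 1 / suc n) Σ ⟩
  ℚ.∣ + 1 / suc n ∣ ℚ.* ℚ.∣ Σ ∣       ≡⟨ cong (ℚ._* ℚ.∣ Σ ∣) (ℚ.0≤p⇒∣p∣≡p (ℚ.nonNegative⁻¹ (+ 1 / suc n))) ⟩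
  (+ 1 / suc n) ℚ.* ℚ.∣ Σ ∣           ≤⟨ ℚ.*-monoˡ-≤-nonNeg (+ 1 / suc n) ∣Σ∣≤ ⟩
  (+ 1 / suc n) ℚ.* (suc n ×ℚ p)      ≡⟨ 1/[1+n]*[[1+n]×p]≡p n p ⟩
  p                                   ∎
  where
  open ℚ.≤-Reasoning
  Σ : ℚ
  Σ = sumℚ (map f xs)
  instance
    1/[1+n]-nonNeg : ℚ.NonNegative (+ 1 / suc n)
    1/[1+n]-nonNeg = ℚ.normalize-nonNeg 1 (suc n)

1/[1+m]<ε : ∀ {ε} → 0ℚ ℚ.< ε → ∃[ M ] (∀ {m} → M ≤ m → + 1 / suc m ℚ.< ε)
1/[1+m]<ε {mkℚ (+ 0)      _   _} (*<* (+<+ ()))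
1/[1+m]<ε {mkℚ -[1+ _ ]   _   _} (*<* ())
-- ε = (k+1)/(d-1+1) ≥ 1/(d-1+1)
1/[1+m]<ε {mkℚ (+ suc k) d-1 _} _ = suc d-1 , λ {m} M≤m →
  ℚ.toℚᵘ-cancel-< (ℚᵘ.<-respˡ-≃ (ℚᵘ.≃-sym (ℚ.toℚᵘ-fromℚᵘ (mkℚᵘ (+ 1) m))) (ℚᵘ.*<* (cross M≤m)))
  where
  cross : ∀ {m} → suc d-1 ≤ m → + 1 ℤ.* + suc d-1 ℤ.< + suc k ℤ.* + suc m
  cross {m} M≤m = subst₂ ℤ._<_ (ℤ.pos-* 1 (suc d-1)) (ℤ.pos-* (suc k) (suc m)) (+<+ (begin-strict
    1 * suc d-1      ≡⟨ *-identityˡ (suc d-1) ⟩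
    suc d-1          ≤⟨ M≤m ⟩
    m                <⟨ n<1+n m ⟩
    suc m            ≤⟨ m≤n*m (suc m) (suc k) ⟩
    suc k * suc m    ∎))
    where open ≤-Reasoning

∣leverage∣≤1/[1+m] : ∀ {n m} → 2 ≤ n → (v : Vertex n (suc m)) → ℚ.∣ leverage v ∣ ℚ.≤ + 1 / suc m
∣leverage∣≤1/[1+m] {n} {m} 2≤n v =
  ∣mean∣≤ _ (nbhd v) (≤-trans (s≤s z≤n) m<deg) (All.map summand≤ (all-filter (T? ∘ adj v) (allVertices n (suc m))))
  where
  m<deg : suc m ≤ deg v
  m<deg = m≤deg 2≤n v
  summand≤ : ∀ {w} → T (adj v w) → ℚ.∣ divℚ (+ deg v ℤ.- + deg w) (deg v + deg w) ∣ ℚ.≤ + 1 / suc m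
  summand≤ {w} vw = ∣[m-n]/[m+n]∣≤1/[1+j] (adj⇒∣deg-deg∣≤1 2≤n v w vw) m<deg

mainTheorem9 : (n : ℕ) → 2 ≤ n →
    (ε : ℚ) → 0ℚ ℚ.< ε →
    ∃[ M ] ((m : ℕ) → M ≤ m → (v : Vertex n m) → ℚ.∣ leverage v ∣ ℚ.< ε)
mainTheorem9 n 2≤n ε ε>0 with 1/[1+m]<ε ε>0
... | M , M≤m⇒<ε = suc M , λ where
  (suc m) (s≤s M≤m) v → ℚ.≤-<-trans (∣leverage∣≤1/[1+m] 2≤n v) (M≤m⇒<ε M≤m)
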